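{- Let $\mathcal{D}$ be a Ryser design of order $v$ and index $\lambda$ with replication numbers $r_1>r_2$, let $r=r_1-r_2$, let $e_1$ be the number of points with replication number $r_1$, and let $D=e_1-r_2$. (1) If $\mathcal{D}$ is of Type-1 with $D=0$, then $v=2\lambda\pm\sqrt{(2\lambda-1)^2+(r-1)^2-1}$ and $(2\lambda-1)^2+r(r-2)$ is a perfect square. (2) If $\mathcal{D}$ is of Type-1 with $D=-1$, then $v=2\lambda\pm\sqrt{(2\lambda-1)^2+(r-1)^2+4r-1}$ and $(2\lambda-1)^2+r(r+2)$ is a perfect square.
   Context: A Ryser design of order $v$ and index $\lambda$ is a pair $(X,L)$ where $X$ is a set of $v$ points and $L$ is a collection of $v$ subsets (blocks) of $X$ such that any two distinct blocks meet in exactly $\lambda$ points, every block has size $>\lambda$, and there exist two blocks of different sizes. It is known that there are integers $r_1> r_2$ with $r_1+r_2=v+1$ such that every point lies in exactly $r_1$ or exactly $r_2$ blocks (the replication numbers). A symmetric $(v,k,\mu)$ design is a set of $v$ points with $v$ blocks, each of size $k$, any two distinct blocks meeting in $\mu\ge1$ points, $k>\mu$. Given such a design with block set $\mathcal{A}$ and a fixed block $A$, the collection $\{A\}\cup\{A\triangle B: B\in\mathcal{A}, B\ne A\}$ (when $k\neq 2\mu$) is a Ryser design; a Ryser design obtained in this way is said to be of Type-1. -}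

module Defs where

open import Data.Nat using (ℕ; _<_; _>_; _+_; suc)
open import Data.Fin using (Fin)
open import Data.Fin.Subset using (Subset; _∩_; _∪_; _─_; ∣_∣; _∈_)
open import Data.Fin.Permutation using (Permutation′; _⟨$⟩ʳ_)
open import Data.Vec using (tabulate)
open import Data.Bool using (Bool; true; false)
open import Data.Nat using (_≡ᵇ_)
open import Data.Product using (Σ; ∃; _×_; ∃-syntax)
open import Data.Sum using (_⊎_)
open import Relation.Binary.PropositionalEquality using (_≡_; _≢_)
open import Relation.Nullary using (¬_)

_△_ : ∀ {n} → Subset n → Subset n → Subset n
A △ B = (A ─ B) ∪ (B ─ A)

countᵇ : ∀ {n} → (Fin n → Bool) → ℕ
countᵇ f = ∣ tabulate f ∣

repl : ∀ {v b} → (Fin b → Subset v) → Fin v → ℕ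
repl {v} {b} B x = countᵇ (λ i → Data.Vec.lookup (B i) x)
  where import Data.Vec

record IsRyser (v λ' : ℕ) (B : Fin v → Subset v) : Set where
  field
    meet      : ∀ i j → i ≢ j → ∣ B i ∩ B j ∣ ≡ λ'
    big       : ∀ i → ∣ B i ∣ > λ'
    twoSizes  : ∃[ i ] ∃[ j ] ∣ B i ∣ ≢ ∣ B j ∣

record AreReplicationNumbers (v : ℕ) (B : Fin v → Subset v) (r₁ r₂ : ℕ) : Set where
  field
    r₂<r₁ : r₂ < r₁
    sum   : r₁ + r₂ ≡ suc v
    each  : ∀ x → repl B x ≡ r₁ ⊎ repl B x ≡ r₂

pointsWithRepl : ∀ {v} → (Fin v → Subset v) → ℕ → ℕ
pointsWithRepl B r = countᵇ (λ x → repl B x ≡ᵇ r)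

record IsSymmetric (v k μ : ℕ) (S : Fin v → Subset v) : Set where
  field
    μ≥1   : 1 Data.Nat.≤ μ
    μ<k   : μ < k
    size  : ∀ i → ∣ S i ∣ ≡ k
    meet  : ∀ i j → i ≢ j → ∣ S i ∩ S j ∣ ≡ μ

-- Type-1: B is (up to relabelling of points, absorbed by the choice of S on
-- Fin v, and relabelling of blocks via a permutation π) the collection
-- {A} ∪ {A △ S j : j ≠ a} for a symmetric (v,k,μ) design S with k ≠ 2μ and
-- A = S a.
record IsType1 (v : ℕ) (B : Fin v → Subset v) : Set where
  field
    k μ   : ℕ
    S     : Fin v → Subset v
    symm  : IsSymmetric v k μ S
    k≢2μ  : k ≢ 2 Data.Nat.* μ
    a     : Fin v
    π     : Permutation′ v
    fixed : B (π ⟨$⟩ʳ a) ≡ S a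
    other : ∀ j → j ≢ a → B (π ⟨$⟩ʳ j) ≡ S a △ S j

module Submission where

-- Let B be obtained from a symmetric (v, k, μ) design S with a fixed block
-- A = Sₐ.  The heart of the proof is the classical fact that a symmetric
-- design has constant replication number k and satisfies k² = (k - μ) + vμ.
-- Since only the block intersections are given, this is proved by linear
-- algebra over ℤ: the block indicators have Gram matrix (k - μ)I + μJ and
-- are therefore independent (every n + 1 vectors of ℤⁿ being dependent, by
-- elimination), so the vector x ↦ k·cₓ - ((k - μ) + vμ), orthogonal to all of
-- them, vanishes.  For B this gives λ = k - μ and replication numbers
-- v + 1 - k on A and k off A; according to which one is r₁ we get
-- (r, e₁, D) = (v + 1 - 2k, k, 0) or (2k - v - 1, v - k, -1), and in both
-- cases (v - 2λ)² is the claimed square.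

open import Defs
open import Data.Nat using (ℕ)
open import Data.Fin using (Fin)
open import Data.Fin.Subset using (Subset)
open import Data.Integer using (ℤ; +_; _+_; _-_; _*_; -_; 0ℤ; 1ℤ; -1ℤ)
open import Data.Product using (_×_; ∃-syntax)
open import Data.Sum using (_⊎_)
open import Relation.Binary.PropositionalEquality using (_≡_)

open import Data.Bool using (Bool; true; false; not; _∧_; _xor_)
open import Data.Bool.Properties using (not-injective)
open import Data.Empty using (⊥-elim)
open import Data.Fin using (zero; suc; punchIn)
open import Data.Fin.Permutation using (_⟨$⟩ʳ_; _⟨$⟩ˡ_; inverseˡ)
open import Data.Fin.Properties using (all?; ¬∀⟶∃¬; punchInᵢ≢i; ¬Fin0)
open import Data.Fin.Subset using (_∩_; ∣_∣; ⊥)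
open import Data.Fin.Subset.Properties using (nonempty?; Empty-unique; ∣⊥∣≡0)
open import Data.Integer using (_≤_; +≤+; -[1+_])
open import Data.Integer.Base using (≢-nonZero)
open import Data.Integer.Properties
open import Data.Integer.Tactic.RingSolver using (solve-∀)
import Data.Nat as ℕ
open import Data.Nat using (zero; suc; z≤n; _≡ᵇ_)
import Data.Nat.Properties as ℕₚ
open import Data.Product using (_,_; proj₁; proj₂)
open import Data.Sum using (inj₁; inj₂; reduce; [_,_]′)
open import Data.Vec using ([]; _∷_; lookup; tabulate)
open import Data.Vec.Properties using (lookup-zipWith; lookup∘tabulate; []=⇒lookup)
open import Data.Vec.Functional using (insertAt)
open import Data.Vec.Functional.Properties using (insertAt-lookup; insertAt-punchIn)
open import Relation.Binary.PropositionalEquality using (refl; sym; trans; cong; cong₂; _≢_; module ≡-Reasoning)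
open import Relation.Nullary using (¬_; yes; no)
open import Algebra.Properties.Semiring.Sum +-*-semiring
  using (sum; sum-cong-≗; sum-remove; ∑-comm; ∑-permute; ∑-distrib-+; *-distribˡ-sum; *-distribʳ-sum; sum-replicate-zero)

⟦_⟧ : Bool → ℤ
⟦ true ⟧ = 1ℤ
⟦ false ⟧ = 0ℤ

χ : ∀ {n} → Subset n → Fin n → ℤ
χ p x = ⟦ lookup p x ⟧

size-as-sum : ∀ {n} (p : Subset n) → + ∣ p ∣ ≡ sum (χ p)
size-as-sum [] = refl
size-as-sum (true ∷ p) = cong (λ s → 1ℤ + s) (size-as-sum p)
size-as-sum (false ∷ p) = trans (size-as-sum p) (sym (+-identityˡ _))

countᵇ-as-sum : ∀ {n} (f : Fin n → Bool) → + countᵇ f ≡ sum (λ i → ⟦ f i ⟧)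
countᵇ-as-sum f = trans (size-as-sum (tabulate f)) (sum-cong-≗ (λ i → cong ⟦_⟧ (lookup∘tabulate f i)))

⟦∧⟧ : ∀ a b → ⟦ a ∧ b ⟧ ≡ ⟦ a ⟧ * ⟦ b ⟧
⟦∧⟧ true true = refl
⟦∧⟧ true false = refl
⟦∧⟧ false b = refl

χ-∩ : ∀ {n} (p q : Subset n) x → χ (p ∩ q) x ≡ χ p x * χ q x
χ-∩ p q x = trans (cong ⟦_⟧ (lookup-zipWith _∧_ x p q)) (⟦∧⟧ (lookup p x) (lookup q x))

χ-idem : ∀ {n} (p : Subset n) x → χ p x * χ p x ≡ χ p x
χ-idem p x with lookup p x
... | true = refl
... | false = refl

⟦not⟧ : ∀ b → ⟦ not b ⟧ ≡ 1ℤ - ⟦ b ⟧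
⟦not⟧ true = refl
⟦not⟧ false = refl

lookup-△ : ∀ {n} (p q : Subset n) x → lookup (p △ q) x ≡ lookup p x xor lookup q x
lookup-△ (true ∷ p) (true ∷ q) zero = refl
lookup-△ (true ∷ p) (false ∷ q) zero = refl
lookup-△ (false ∷ p) (true ∷ q) zero = refl
lookup-△ (false ∷ p) (false ∷ q) zero = refl
lookup-△ (_ ∷ p) (_ ∷ q) (suc x) = lookup-△ p q x

⟦∧xor⟧ : ∀ a b → ⟦ a ⟧ * ⟦ a xor b ⟧ ≡ ⟦ a ⟧ - ⟦ a ⟧ * ⟦ b ⟧
⟦∧xor⟧ true true = refl
⟦∧xor⟧ true false = refl
⟦∧xor⟧ false b = refl

⟦≡ᵇ⟧-equal : ∀ {m n} → m ≡ n → ⟦ m ≡ᵇ n ⟧ ≡ 1ℤ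
⟦≡ᵇ⟧-equal {m} refl with m ≡ᵇ m | ℕₚ.≡⇒≡ᵇ m m refl
... | true | _ = refl

⟦≡ᵇ⟧-distinct : ∀ {m n} → m ≢ n → ⟦ m ≡ᵇ n ⟧ ≡ 0ℤ
⟦≡ᵇ⟧-distinct {m} {n} m≢n with m ≡ᵇ n | ℕₚ.≡ᵇ⇒≡ m n
... | true | m≡n = ⊥-elim (m≢n (m≡n _))
... | false | _ = refl

sum-const : ∀ n (c : ℤ) → sum {n} (λ _ → c) ≡ + n * c
sum-const zero c = refl
sum-const (suc n) c = trans (cong (λ s → c + s) (sum-const n c)) (step c (+ n))
  where
  step : ∀ c m → c + m * c ≡ (1ℤ + m) * c
  step = solve-∀

sum-zero : ∀ {n} (f : Fin n → ℤ) → (∀ i → f i ≡ 0ℤ) → sum f ≡ 0ℤ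
sum-zero {n} f f≡0 = trans (sum-cong-≗ f≡0) (sum-replicate-zero n)

sum-linear : ∀ {n} (α β : ℤ) (f g : Fin n → ℤ) →
             sum (λ i → α * f i + β * g i) ≡ α * sum f + β * sum g
sum-linear α β f g = trans (∑-distrib-+ (λ i → α * f i) (λ i → β * g i))
  (sym (cong₂ _+_ (*-distribˡ-sum α f) (*-distribˡ-sum β g)))

sum-sub : ∀ {n} (f g : Fin n → ℤ) → sum (λ i → f i - g i) ≡ sum f - sum g
sum-sub f g = begin
  sum (λ i → f i - g i)                     ≡⟨ sum-cong-≗ (λ i → as-linear (f i) (g i)) ⟩
  sum (λ i → 1ℤ * f i + (- 1ℤ) * g i)       ≡⟨ sum-linear 1ℤ (- 1ℤ) f g ⟩
  1ℤ * sum f + (- 1ℤ) * sum g               ≡⟨ as-linear (sum f) (sum g) ⟨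
  sum f - sum g                             ∎
  where
  open ≡-Reasoning
  as-linear : ∀ x y → x - y ≡ 1ℤ * x + (- 1ℤ) * y
  as-linear = solve-∀

sum-without : ∀ {n} (f : Fin (suc n) → ℤ) p → sum (λ j → f (punchIn p j)) ≡ sum f - f p
sum-without f p = begin
  sum (λ j → f (punchIn p j))               ≡⟨ add-and-subtract (f p) _ ⟩
  (f p + sum (λ j → f (punchIn p j))) - f p ≡⟨ cong (_- f p) (sum-remove f) ⟨
  sum f - f p                               ∎
  where
  open ≡-Reasoning
  add-and-subtract : ∀ a b → b ≡ (a + b) - a
  add-and-subtract = solve-∀

size-∩-△ : ∀ {n} (p q : Subset n) → + ∣ p ∩ (p △ q) ∣ ≡ + ∣ p ∣ - + ∣ p ∩ q ∣
size-∩-△ p q = begin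
  + ∣ p ∩ (p △ q) ∣                     ≡⟨ size-as-sum (p ∩ (p △ q)) ⟩
  sum (χ (p ∩ (p △ q)))                 ≡⟨ sum-cong-≗ pointwise ⟩
  sum (λ x → χ p x - χ (p ∩ q) x)       ≡⟨ sum-sub (χ p) (χ (p ∩ q)) ⟩
  sum (χ p) - sum (χ (p ∩ q))           ≡⟨ cong₂ _-_ (size-as-sum p) (size-as-sum (p ∩ q)) ⟨
  + ∣ p ∣ - + ∣ p ∩ q ∣                 ∎
  where
  open ≡-Reasoning
  pointwise : ∀ x → χ (p ∩ (p △ q)) x ≡ χ p x - χ (p ∩ q) x
  pointwise x = begin
    χ (p ∩ (p △ q)) x                               ≡⟨ χ-∩ p (p △ q) x ⟩
    χ p x * ⟦ lookup (p △ q) x ⟧                    ≡⟨ cong (λ b → χ p x * ⟦ b ⟧) (lookup-△ p q x) ⟩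
    χ p x * ⟦ lookup p x xor lookup q x ⟧           ≡⟨ ⟦∧xor⟧ (lookup p x) (lookup q x) ⟩
    χ p x - χ p x * χ q x                           ≡⟨ cong (λ t → χ p x - t) (χ-∩ p q x) ⟨
    χ p x - χ (p ∩ q) x                             ∎

count-value : ∀ {n} (f : Fin n → ℕ) α (P : Fin n → Bool) →
              (∀ x → P x ≡ true → f x ≡ α) → (∀ x → P x ≡ false → f x ≢ α) →
              + countᵇ (λ x → f x ≡ᵇ α) ≡ sum (λ x → ⟦ P x ⟧)
count-value f α P value-on-P value-off-P = trans (countᵇ-as-sum (λ x → f x ≡ᵇ α)) (sum-cong-≗ pointwise)
  where
  pointwise : ∀ x → ⟦ f x ≡ᵇ α ⟧ ≡ ⟦ P x ⟧
  pointwise x with P x in Px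
  ... | true = ⟦≡ᵇ⟧-equal (value-on-P x Px)
  ... | false = ⟦≡ᵇ⟧-distinct (value-off-P x Px)

0≤i*i : ∀ i → 0ℤ ≤ i * i
0≤i*i (+ zero) = ≤-refl
0≤i*i (+ suc n) = +≤+ z≤n
0≤i*i (-[1+ n ]) = +≤+ z≤n

sum-nonneg : ∀ {n} (f : Fin n → ℤ) → (∀ i → 0ℤ ≤ f i) → 0ℤ ≤ sum f
sum-nonneg {zero} f f≥0 = ≤-refl
sum-nonneg {suc n} f f≥0 = +-mono-≤ (f≥0 zero) (sum-nonneg (λ i → f (suc i)) (λ i → f≥0 (suc i)))

sum-squares-zero : ∀ {n} (g : Fin n → ℤ) → sum (λ x → g x * g x) ≡ 0ℤ → ∀ y → g y ≡ 0ℤ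
sum-squares-zero {suc n} g Σg²≡0 y = square-zero (≤-antisym gy²≤0 (0≤i*i (g y)))
  where
  rest : ℤ
  rest = sum (λ j → g (punchIn y j) * g (punchIn y j))
  gy²≤0 : g y * g y ≤ 0ℤ
  gy²≤0 = begin
    g y * g y         ≡⟨ +-identityʳ _ ⟨
    g y * g y + 0ℤ    ≤⟨ +-monoʳ-≤ (g y * g y) (sum-nonneg _ (λ j → 0≤i*i (g (punchIn y j)))) ⟩
    g y * g y + rest  ≡⟨ trans (sym (sum-remove (λ x → g x * g x))) Σg²≡0 ⟩
    0ℤ                ∎
    where open ≤-Reasoning
  square-zero : g y * g y ≡ 0ℤ → g y ≡ 0ℤ
  square-zero e = reduce (i*j≡0⇒i≡0∨j≡0 (g y) e)

nonzero-factor : ∀ {x y} → x ≢ 0ℤ → x * y ≡ 0ℤ → y ≡ 0ℤ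
nonzero-factor {x} x≢0 xy≡0 = [ (λ x≡0 → ⊥-elim (x≢0 x≡0)) , (λ y≡0 → y≡0) ]′ (i*j≡0⇒i≡0∨j≡0 x xy≡0)

complement : ∀ {x y s t : ℤ} → x + y ≡ s → x ≡ s - t → y ≡ t
complement {x} {y} {s} {t} x+y≡s x≡s-t = begin
  y                  ≡⟨ cancel x y ⟩
  (x + y) - x        ≡⟨ cong₂ _-_ x+y≡s x≡s-t ⟩
  s - (s - t)        ≡⟨ cancel′ s t ⟩
  t                  ∎
  where
  open ≡-Reasoning
  cancel : ∀ x y → y ≡ (x + y) - x
  cancel = solve-∀
  cancel′ : ∀ s t → s - (s - t) ≡ t
  cancel′ = solve-∀

_·_ : ∀ {n} → (Fin n → ℤ) → (Fin n → ℤ) → ℤ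
u · w = sum (λ x → u x * w x)
infix 7 _·_

·-comm : ∀ {n} (u w : Fin n → ℤ) → u · w ≡ w · u
·-comm u w = sum-cong-≗ (λ x → *-comm (u x) (w x))

combination : ∀ {m n} → (Fin m → ℤ) → (Fin m → Fin n → ℤ) → Fin n → ℤ
combination a w x = sum (λ j → a j * w j x)

Dependent : ∀ {m n} → (Fin m → Fin n → ℤ) → Set
Dependent w = ∃[ a ] (∃[ i ] a i ≢ 0ℤ) × (∀ x → combination a w x ≡ 0ℤ)

Independent : ∀ {m n} → (Fin m → Fin n → ℤ) → Set
Independent w = ∀ a → (∀ x → combination a w x ≡ 0ℤ) → ∀ j → a j ≡ 0ℤ

combination-· : ∀ {m n} (a : Fin m → ℤ) (w : Fin m → Fin n → ℤ) (h : Fin n → ℤ) →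
                combination a w · h ≡ sum (λ j → a j * (w j · h))
combination-· a w h = begin
  sum (λ x → sum (λ j → a j * w j x) * h x)  ≡⟨ sum-cong-≗ (λ x → *-distribʳ-sum (h x) (λ j → a j * w j x)) ⟩
  sum (λ x → sum (λ j → a j * w j x * h x))  ≡⟨ ∑-comm (λ x j → a j * w j x * h x) ⟩
  sum (λ j → sum (λ x → a j * w j x * h x))  ≡⟨ sum-cong-≗ (λ j → sum-cong-≗ (λ x → *-assoc (a j) (w j x) (h x))) ⟩
  sum (λ j → sum (λ x → a j * (w j x * h x))) ≡⟨ sum-cong-≗ (λ j → *-distribˡ-sum (a j) (λ x → w j x * h x)) ⟨
  sum (λ j → a j * (w j · h))                 ∎
  where open ≡-Reasoning

-- Gaussian elimination on the first coordinate.  If that coordinate vanishes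
-- on every vector, a dependence among the other vectors' remaining
-- coordinates is already a dependence of the family.
dependent-zero-column : ∀ {m n} (w : Fin (suc m) → Fin (suc n) → ℤ) → (∀ i → w i zero ≡ 0ℤ) →
                        Dependent (λ j x → w (suc j) (suc x)) → Dependent w
dependent-zero-column {m} w column≡0 (b , (i , bᵢ≢0) , b-vanishes) = a , (suc i , bᵢ≢0) , vanishes
  where
  a : Fin (suc m) → ℤ
  a zero = 0ℤ
  a (suc j) = b j
  vanishes : ∀ x → combination a w x ≡ 0ℤ
  vanishes zero = sum-zero _ (λ j → trans (cong (a j *_) (column≡0 j)) (*-zeroʳ (a j)))
  vanishes (suc x) = trans (+-identityˡ _) (b-vanishes x)

-- Otherwise pick a pivot p with q = (w p)₀ ≢ 0 and clear the first
-- coordinate of every other vector: wⱼ ↦ q wⱼ - (wⱼ)₀ wₚ.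
eliminate : ∀ {m n} → (Fin (suc m) → Fin (suc n) → ℤ) → Fin (suc m) → Fin m → Fin n → ℤ
eliminate w p j x = w p zero * w (punchIn p j) (suc x) - w (punchIn p j) zero * w p (suc x)

dependent-pivot : ∀ {m n} (w : Fin (suc m) → Fin (suc n) → ℤ) p → w p zero ≢ 0ℤ →
                  Dependent (eliminate w p) → Dependent w
dependent-pivot {m} {n} w p q≢0 (b , (i , bᵢ≢0) , b-vanishes) = a , (punchIn p i , aᵢ≢0) , vanishes
  where
  q : ℤ
  q = w p zero
  T : Fin (suc n) → ℤ
  T x = sum (λ j → b j * w (punchIn p j) x)
  a : Fin (suc m) → ℤ
  a = insertAt (λ j → q * b j) p (- T zero)
  aᵢ≢0 : a (punchIn p i) ≢ 0ℤ
  aᵢ≢0 aᵢ≡0 = bᵢ≢0 (nonzero-factor q≢0 (trans (sym (insertAt-punchIn _ p _ i)) aᵢ≡0))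
  expand : ∀ x → combination a w x ≡ - T zero * w p x + q * T x
  expand x = begin
    combination a w x
      ≡⟨ sum-remove {i = p} (λ j → a j * w j x) ⟩
    a p * w p x + sum (λ j → a (punchIn p j) * w (punchIn p j) x)
      ≡⟨ cong (λ c → c * w p x + sum (λ j → a (punchIn p j) * w (punchIn p j) x)) (insertAt-lookup _ p _) ⟩
    - T zero * w p x + sum (λ j → a (punchIn p j) * w (punchIn p j) x)
      ≡⟨ cong (λ s → - T zero * w p x + s) (sum-cong-≗ (λ j →
           trans (cong (_* w (punchIn p j) x) (insertAt-punchIn _ p _ j)) (*-assoc q (b j) _))) ⟩
    - T zero * w p x + sum (λ j → q * (b j * w (punchIn p j) x))
      ≡⟨ cong (λ s → - T zero * w p x + s) (*-distribˡ-sum q (λ j → b j * w (punchIn p j) x)) ⟨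
    - T zero * w p x + q * T x ∎
    where open ≡-Reasoning
  vanishes : ∀ x → combination a w x ≡ 0ℤ
  vanishes zero = trans (expand zero) (cancel (T zero) q)
    where
    cancel : ∀ t q → - t * q + q * t ≡ 0ℤ
    cancel = solve-∀
  vanishes (suc x) = begin
    combination a w (suc x)           ≡⟨ expand (suc x) ⟩
    - T zero * c + q * T (suc x)       ≡⟨ reorder (T zero) c q (T (suc x)) ⟩
    q * T (suc x) + (- c) * T zero     ≡⟨ sum-linear q (- c) (λ j → b j * w (punchIn p j) (suc x)) (λ j → b j * w (punchIn p j) zero) ⟨
    sum (λ j → q * (b j * w (punchIn p j) (suc x)) + (- c) * (b j * w (punchIn p j) zero))
                                      ≡⟨ sum-cong-≗ (λ j → distribute (b j) q (w (punchIn p j) (suc x)) (w (punchIn p j) zero) c) ⟩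
    combination b (eliminate w p) x    ≡⟨ b-vanishes x ⟩
    0ℤ                                 ∎
    where
    open ≡-Reasoning
    c : ℤ
    c = w p (suc x)
    reorder : ∀ t c q u → - t * c + q * u ≡ q * u + (- c) * t
    reorder = solve-∀
    distribute : ∀ b q A B c → q * (b * A) + (- c) * (b * B) ≡ b * (q * A - B * c)
    distribute = solve-∀

dependent : ∀ n (w : Fin (suc n) → Fin n → ℤ) → Dependent w
dependent zero w = (λ _ → 1ℤ) , (zero , λ ()) , (λ ())
dependent (suc n) w with all? (λ i → w i zero ≟ 0ℤ)
... | yes column≡0 = dependent-zero-column w column≡0 (dependent n (λ j x → w (suc j) (suc x)))
... | no ¬column≡0 with ¬∀⟶∃¬ _ (λ i → w i zero ≡ 0ℤ) (λ i → w i zero ≟ 0ℤ) ¬column≡0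
...   | p , q≢0 = dependent-pivot w p q≢0 (dependent n (eliminate w p))

-- A non-empty family of m vectors with Gram matrix (K - M) I + M J.  It is
-- independent as soon as both eigenvalues K - M and (K - M) + m M of that
-- matrix are non-zero.
module Gram {m′ n} (w : Fin (suc m′) → Fin n → ℤ) (K M : ℤ)
            (diagonal : ∀ j → w j · w j ≡ K)
            (off-diagonal : ∀ j l → j ≢ l → w j · w l ≡ M) where

  m : ℕ
  m = suc m′

  gram-row : ∀ (a : Fin m → ℤ) l → sum (λ j → a j * (w j · w l)) ≡ (K - M) * a l + M * sum a
  gram-row a l = begin
    sum (λ j → a j * (w j · w l))
      ≡⟨ sum-remove {i = l} (λ j → a j * (w j · w l)) ⟩
    a l * (w l · w l) + sum (λ j → a (punchIn l j) * (w (punchIn l j) · w l))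
      ≡⟨ cong₂ (λ d s → a l * d + s) (diagonal l) (sum-cong-≗ (λ j →
           cong (a (punchIn l j) *_) (off-diagonal (punchIn l j) l (punchInᵢ≢i l j)))) ⟩
    a l * K + sum (λ j → a (punchIn l j) * M)
      ≡⟨ cong (λ s → a l * K + s) (trans (sum-cong-≗ (λ j → *-comm (a (punchIn l j)) M))
                                   (sym (*-distribˡ-sum M (λ j → a (punchIn l j))))) ⟩
    a l * K + M * sum (λ j → a (punchIn l j))
      ≡⟨ cong (λ s → a l * K + M * s) (sum-without a l) ⟩
    a l * K + M * (sum a - a l)
      ≡⟨ regroup (a l) K M (sum a) ⟩
    (K - M) * a l + M * sum a ∎
    where
    open ≡-Reasoning
    regroup : ∀ x K M s → x * K + M * (s - x) ≡ (K - M) * x + M * s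
    regroup = solve-∀

  independent : K - M ≢ 0ℤ → (K - M) + + m * M ≢ 0ℤ → Independent w
  independent K-M≢0 E≢0 a vanishes = aₗ≡0
    where
    -- dotting the vanishing combination with w l
    row : ∀ l → (K - M) * a l + M * sum a ≡ 0ℤ
    row l = trans (sym (gram-row a l)) (trans (sym (combination-· a w (w l)))
                    (sum-zero _ (λ x → trans (cong (_* w l x) (vanishes x)) (*-zeroˡ (w l x)))))
    total≡0 : ((K - M) + + m * M) * sum a ≡ 0ℤ
    total≡0 = begin
      ((K - M) + + m * M) * sum a                      ≡⟨ regroup (K - M) M (+ m) (sum a) ⟩
      (K - M) * sum a + M * (+ m * sum a)              ≡⟨ cong (λ s → (K - M) * sum a + M * s) (sum-const m (sum a)) ⟨
      (K - M) * sum a + M * sum {m} (λ _ → sum a)      ≡⟨ sum-linear (K - M) M a (λ _ → sum a) ⟨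
      sum (λ l → (K - M) * a l + M * sum a)            ≡⟨ sum-zero _ row ⟩
      0ℤ                                               ∎
      where
      open ≡-Reasoning
      regroup : ∀ d M m s → (d + m * M) * s ≡ d * s + M * (m * s)
      regroup = solve-∀
    Σa≡0 : sum a ≡ 0ℤ
    Σa≡0 = nonzero-factor E≢0 total≡0
    aₗ≡0 : ∀ l → a l ≡ 0ℤ
    aₗ≡0 l = nonzero-factor K-M≢0 (begin
      (K - M) * a l                 ≡⟨ drop-zero ((K - M) * a l) M ⟨
      (K - M) * a l + M * 0ℤ        ≡⟨ cong (λ s → (K - M) * a l + M * s) Σa≡0 ⟨
      (K - M) * a l + M * sum a     ≡⟨ row l ⟩
      0ℤ                            ∎)
      where
      open ≡-Reasoning
      drop-zero : ∀ x M → x + M * 0ℤ ≡ x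
      drop-zero = solve-∀

-- n independent vectors of ℤⁿ leave no non-zero vector orthogonal to all of
-- them: adjoining such a g yields n + 1 vectors, which are dependent, and
-- dotting the dependence a₀ g + Σⱼ aⱼ₊₁ sⱼ = 0 with g gives a₀ (g · g) = 0,
-- where a₀ ≢ 0 by the independence of the sⱼ.
orthogonal-to-independent : ∀ {n} (s : Fin n → Fin n → ℤ) → Independent s →
                            (g : Fin n → ℤ) → (∀ j → s j · g ≡ 0ℤ) → ∀ x → g x ≡ 0ℤ
orthogonal-to-independent {n} s s-independent g g⊥s = from-dependence (dependent n w)
  where
  w : Fin (suc n) → Fin n → ℤ
  w zero = g
  w (suc j) = s j

  from-dependence : Dependent w → ∀ x → g x ≡ 0ℤ
  from-dependence (a , (i , aᵢ≢0) , vanishes) = sum-squares-zero g (nonzero-factor a₀≢0 a₀g·g≡0)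
    where
    a₀g·g≡0 : a zero * (g · g) ≡ 0ℤ
    a₀g·g≡0 = begin
      a zero * (g · g)                                     ≡⟨ +-identityʳ _ ⟨
      a zero * (g · g) + 0ℤ                                ≡⟨ cong (λ t → a zero * (g · g) + t)
                                                              (sum-zero _ (λ j → trans (cong (a (suc j) *_) (g⊥s j)) (*-zeroʳ (a (suc j))))) ⟨
      a zero * (g · g) + sum (λ j → a (suc j) * (s j · g)) ≡⟨ combination-· a w g ⟨
      combination a w · g                                  ≡⟨ sum-zero _ (λ x → trans (cong (_* g x) (vanishes x)) (*-zeroˡ (g x))) ⟩
      0ℤ                                                   ∎
      where open ≡-Reasoning
    trivial : a zero ≡ 0ℤ → ∀ i → a i ≡ 0ℤ
    trivial a₀≡0 zero = a₀≡0
    trivial a₀≡0 (suc j) = s-independent (λ j → a (suc j))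
      (λ x → trans (sym (trans (cong (λ c → c * g x + combination (λ j → a (suc j)) s x) a₀≡0) (+-identityˡ _))) (vanishes x)) j
    a₀≢0 : a zero ≢ 0ℤ
    a₀≢0 a₀≡0 = aᵢ≢0 (trivial a₀≡0 i)

-- The block indicators χⱼ have Gram matrix
-- (k - μ) I + μ J, so they are independent; the defect vector
-- x ↦ k cₓ - ((k - μ) + v μ), where cₓ is the number of blocks through x,
-- is orthogonal to every χⱼ and hence vanishes.  Summing kcₓ over x
-- gives v k² = v ((k - μ) + v μ).
module SymmetricDesign {n k μ : ℕ} {S : Fin (suc n) → Subset (suc n)}
                       (symmetric : IsSymmetric (suc n) k μ S) where
  open IsSymmetric symmetric

  V K M E : ℤ
  V = + suc n
  K = + k
  M = + μ
  E = (K - M) + V * M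

  incidence : Fin (suc n) → Fin (suc n) → ℤ
  incidence j = χ (S j)

  column : Fin (suc n) → ℤ
  column x = sum (λ j → incidence j x)

  block-size : ∀ j → sum (incidence j) ≡ K
  block-size j = trans (sym (size-as-sum (S j))) (cong +_ (size j))

  gram-diagonal : ∀ j → incidence j · incidence j ≡ K
  gram-diagonal j = trans (sum-cong-≗ (χ-idem (S j))) (block-size j)

  gram-off-diagonal : ∀ j l → j ≢ l → incidence j · incidence l ≡ M
  gram-off-diagonal j l j≢l = trans (sum-cong-≗ (λ x → sym (χ-∩ (S j) (S l) x)))
                                    (trans (sym (size-as-sum (S j ∩ S l))) (cong +_ (meet j l j≢l)))

  open Gram incidence K M gram-diagonal gram-off-diagonal using (gram-row; independent)

  K≢0 : K ≢ 0ℤ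
  K≢0 K≡0 = ℕₚ.<⇒≢ (ℕₚ.≤-<-trans z≤n μ<k) (sym (+-injective K≡0))

  K-M≢0 : K - M ≢ 0ℤ
  K-M≢0 K-M≡0 = ℕₚ.<⇒≢ μ<k (sym (+-injective (i-j≡0⇒i≡j K M K-M≡0)))

  E≢0 : E ≢ 0ℤ
  E≢0 E≡0 = K≢0 (cong +_ (ℕₚ.m+n≡0⇒m≡0 k (+-injective (trans (sym E-natural) E≡0))))
    where
    E-natural : E ≡ + (k ℕ.+ n ℕ.* μ)
    E-natural = begin
      E                        ≡⟨ regroup K M (+ n) ⟩
      K + + n * M              ≡⟨ cong (λ t → K + t) (pos-* n μ) ⟨
      K + + (n ℕ.* μ)          ≡⟨ pos-+ k (n ℕ.* μ) ⟨
      + (k ℕ.+ n ℕ.* μ)        ∎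
      where
      open ≡-Reasoning
      regroup : ∀ K M n → (K - M) + (1ℤ + n) * M ≡ K + n * M
      regroup = solve-∀

  -- χⱼ · c = Σₗ χₗ · χⱼ is a row sum of the Gram matrix
  column-incidence : ∀ j → incidence j · column ≡ E
  column-incidence j = begin
    incidence j · column                             ≡⟨ ·-comm (incidence j) column ⟩
    column · incidence j                             ≡⟨ sum-cong-≗ (λ x → cong (_* incidence j x)
                                                          (sum-cong-≗ (λ l → sym (*-identityˡ (incidence l x))))) ⟩
    combination (λ _ → 1ℤ) incidence · incidence j   ≡⟨ combination-· (λ _ → 1ℤ) incidence (incidence j) ⟩
    sum (λ l → 1ℤ * (incidence l · incidence j))     ≡⟨ gram-row (λ _ → 1ℤ) j ⟩
    (K - M) * 1ℤ + M * sum {suc n} (λ _ → 1ℤ)        ≡⟨ cong (λ t → (K - M) * 1ℤ + M * t) (sum-const (suc n) 1ℤ) ⟩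
    (K - M) * 1ℤ + M * (V * 1ℤ)                      ≡⟨ regroup K M V ⟩
    E                                                ∎
    where
    open ≡-Reasoning
    regroup : ∀ K M V → (K - M) * 1ℤ + M * (V * 1ℤ) ≡ (K - M) + V * M
    regroup = solve-∀

  defect : Fin (suc n) → ℤ
  defect x = K * column x - E

  defect-orthogonal : ∀ j → incidence j · defect ≡ 0ℤ
  defect-orthogonal j = begin
    incidence j · defect                                          ≡⟨ sum-cong-≗ (λ x → expand (incidence j x) K (column x) E) ⟩
    sum (λ x → K * (incidence j x * column x) + (- E) * incidence j x) ≡⟨ sum-linear K (- E) (λ x → incidence j x * column x) (incidence j) ⟩
    K * (incidence j · column) + (- E) * sum (incidence j)         ≡⟨ cong₂ (λ s t → K * s + (- E) * t) (column-incidence j) (block-size j) ⟩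
    K * E + (- E) * K                                              ≡⟨ cancel K E ⟩
    0ℤ                                                             ∎
    where
    open ≡-Reasoning
    expand : ∀ χ K c E → χ * (K * c - E) ≡ K * (χ * c) + (- E) * χ
    expand = solve-∀
    cancel : ∀ K E → K * E + (- E) * K ≡ 0ℤ
    cancel = solve-∀

  -- as the block indicators are independent, the defect vanishes
  K*column≡E : ∀ x → K * column x ≡ E
  K*column≡E x = i-j≡0⇒i≡j _ _ (orthogonal-to-independent incidence (independent K-M≢0 E≢0) defect defect-orthogonal x)

  fisher : K * K ≡ E
  fisher = *-cancelˡ-≡ V (K * K) E (begin
    V * (K * K)                 ≡⟨ rearrange V K ⟩
    K * (V * K)                 ≡⟨ cong (K *_) (sum-const (suc n) K) ⟨
    K * sum {suc n} (λ _ → K)   ≡⟨ cong (K *_) (sum-cong-≗ block-size) ⟨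
    K * sum (λ j → sum (incidence j)) ≡⟨ cong (K *_) (∑-comm (λ j x → incidence j x)) ⟩
    K * sum column              ≡⟨ *-distribˡ-sum K column ⟩
    sum (λ x → K * column x)    ≡⟨ sum-cong-≗ K*column≡E ⟩
    sum {suc n} (λ _ → E)       ≡⟨ sum-const (suc n) E ⟩
    V * E                       ∎)
    where
    open ≡-Reasoning
    rearrange : ∀ V K → V * (K * K) ≡ K * (V * K)
    rearrange = solve-∀

  column-constant : ∀ x → column x ≡ K
  column-constant x = *-cancelˡ-≡ K (column x) K {{≢-nonZero K≢0}} (trans (K*column≡E x) (sym fisher))

Type1Parameters : (V K R₁ R₂ E₁ : ℤ) → Set
Type1Parameters V K R₁ R₂ E₁ = (R₁ ≡ V + 1ℤ - K × R₂ ≡ K × E₁ ≡ K) ⊎ (R₁ ≡ K × R₂ ≡ V + 1ℤ - K × E₁ ≡ V - K)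

module Type1 {n : ℕ} {B : Fin (suc n) → Subset (suc n)} (type1 : IsType1 (suc n) B) where
  open IsType1 type1
  open SymmetricDesign symm public using (V; K; M; fisher)
  open SymmetricDesign symm using (K≢0; column-constant)

  A : Subset (suc n)
  A = S a

  A-size : + ∣ A ∣ ≡ K
  A-size = cong +_ (IsSymmetric.size symm a)

  other-blocks : ∀ j → B (π ⟨$⟩ʳ punchIn a j) ≡ A △ S (punchIn a j)
  other-blocks j = other (punchIn a j) (punchInᵢ≢i a j)

  replication-sum : ∀ x → + repl B x ≡ χ A x + sum (λ j → ⟦ lookup A x xor lookup (S (punchIn a j)) x ⟧)
  replication-sum x = begin
    + repl B x                                                    ≡⟨ countᵇ-as-sum (λ i → lookup (B i) x) ⟩
    sum (λ i → χ (B i) x)                                         ≡⟨ ∑-permute (λ i → χ (B i) x) π ⟩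
    sum (λ i → χ (B (π ⟨$⟩ʳ i)) x)                                ≡⟨ sum-remove {i = a} (λ i → χ (B (π ⟨$⟩ʳ i)) x) ⟩
    χ (B (π ⟨$⟩ʳ a)) x + sum (λ j → χ (B (π ⟨$⟩ʳ punchIn a j)) x) ≡⟨ cong₂ (λ P s → χ P x + s) fixed
                                                                       (sum-cong-≗ (λ j → trans (cong (λ P → χ P x) (other-blocks j))
                                                                                               (cong ⟦_⟧ (lookup-△ A _ x)))) ⟩
    χ A x + sum (λ j → ⟦ lookup A x xor lookup (S (punchIn a j)) x ⟧) ∎
    where open ≡-Reasoning

  others-through : ∀ x → sum (λ j → χ (S (punchIn a j)) x) ≡ K - χ A x
  others-through x = trans (sum-without (λ j → χ (S j) x) a) (cong (_- χ A x) (column-constant x))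

  -- a point of A lies in A and in the A △ Sⱼ with x ∉ Sⱼ: 1 + n - (k - 1) blocks
  replication-inside : ∀ x → lookup A x ≡ true → + repl B x ≡ V + 1ℤ - K
  replication-inside x x∈A = begin
    + repl B x                                                   ≡⟨ replication-sum x ⟩
    χ A x + sum (λ j → ⟦ lookup A x xor lookup (S (punchIn a j)) x ⟧)
      ≡⟨ cong (λ b → ⟦ b ⟧ + sum (λ j → ⟦ b xor lookup (S (punchIn a j)) x ⟧)) x∈A ⟩
    1ℤ + sum (λ j → ⟦ not (lookup (S (punchIn a j)) x) ⟧)      ≡⟨ cong (λ s → 1ℤ + s) (sum-cong-≗ (λ j → ⟦not⟧ (lookup (S (punchIn a j)) x))) ⟩
    1ℤ + sum (λ j → 1ℤ - χ (S (punchIn a j)) x)                ≡⟨ cong (λ s → 1ℤ + s) (sum-sub (λ _ → 1ℤ) (λ j → χ (S (punchIn a j)) x)) ⟩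
    1ℤ + (sum {n} (λ _ → 1ℤ) - sum (λ j → χ (S (punchIn a j)) x))
      ≡⟨ cong₂ (λ s t → 1ℤ + (s - t)) (sum-const n 1ℤ) (others-through x) ⟩
    1ℤ + (+ n * 1ℤ - (K - χ A x))                               ≡⟨ cong (λ b → 1ℤ + (+ n * 1ℤ - (K - ⟦ b ⟧))) x∈A ⟩
    1ℤ + (+ n * 1ℤ - (K - 1ℤ))                                  ≡⟨ regroup (+ n) K ⟩
    V + 1ℤ - K                                                  ∎
    where
    open ≡-Reasoning
    regroup : ∀ N K → 1ℤ + (N * 1ℤ - (K - 1ℤ)) ≡ (1ℤ + N) + 1ℤ - K
    regroup = solve-∀

  -- a point outside A lies in the A △ Sⱼ with x ∈ Sⱼ: k blocks
  replication-outside : ∀ x → lookup A x ≡ false → + repl B x ≡ K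
  replication-outside x x∉A = begin
    + repl B x                                                   ≡⟨ replication-sum x ⟩
    χ A x + sum (λ j → ⟦ lookup A x xor lookup (S (punchIn a j)) x ⟧)
      ≡⟨ cong (λ b → ⟦ b ⟧ + sum (λ j → ⟦ b xor lookup (S (punchIn a j)) x ⟧)) x∉A ⟩
    0ℤ + sum (λ j → χ (S (punchIn a j)) x)                      ≡⟨ +-identityˡ _ ⟩
    sum (λ j → χ (S (punchIn a j)) x)                           ≡⟨ others-through x ⟩
    K - χ A x                                                   ≡⟨ cong (λ b → K - ⟦ b ⟧) x∉A ⟩
    K - 0ℤ                                                      ≡⟨ +-identityʳ K ⟩
    K                                                           ∎
    where open ≡-Reasoning

  -- blocks of B meet in k - μ points: compare A with A △ S (punchIn a j)
  index : ∀ {λ'} → IsRyser (suc n) λ' B → Fin n → + λ' ≡ K - M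
  index {λ'} ryser j = begin
    + λ'                                         ≡⟨ cong +_ (IsRyser.meet ryser _ _ distinct) ⟨
    + ∣ B (π ⟨$⟩ʳ a) ∩ B (π ⟨$⟩ʳ j′) ∣           ≡⟨ cong₂ (λ P Q → + ∣ P ∩ Q ∣) fixed (other-blocks j) ⟩
    + ∣ A ∩ (A △ S j′) ∣                         ≡⟨ size-∩-△ A (S j′) ⟩
    + ∣ A ∣ - + ∣ A ∩ S j′ ∣                     ≡⟨ cong₂ _-_ A-size (cong +_ (IsSymmetric.meet symm a j′ (λ e → punchInᵢ≢i a j (sym e)))) ⟩
    K - M                                        ∎
    where
    open ≡-Reasoning
    j′ : Fin (suc n)
    j′ = punchIn a j
    distinct : π ⟨$⟩ʳ a ≢ π ⟨$⟩ʳ j′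
    distinct e = punchInᵢ≢i a j (trans (sym (inverseˡ π)) (trans (cong (π ⟨$⟩ˡ_) (sym e)) (inverseˡ π)))

  -- A is non-empty, having k > μ ≥ 0 points.
  point-of-A : ∃[ x ] lookup A x ≡ true
  point-of-A with nonempty? A
  ... | yes (x , x∈A) = x , []=⇒lookup x∈A
  ... | no A-empty = ⊥-elim (K≢0 (begin
    K                       ≡⟨ A-size ⟨
    + ∣ A ∣                 ≡⟨ cong (λ P → + ∣ P ∣) (Empty-unique A-empty) ⟩
    + ∣ ⊥ {n = suc n} ∣     ≡⟨ cong +_ (∣⊥∣≡0 (suc n)) ⟩
    0ℤ                      ∎))
    where open ≡-Reasoning

  module _ {r₁ r₂} (replication : AreReplicationNumbers (suc n) B r₁ r₂) where
    open AreReplicationNumbers replication using (r₂<r₁; each) renaming (sum to r₁+r₂≡1+v)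

    r₁+r₂ : + r₁ + + r₂ ≡ V + 1ℤ
    r₁+r₂ = trans (sym (pos-+ r₁ r₂)) (trans (cong +_ r₁+r₂≡1+v) (+-comm 1ℤ V))

    r₁≢r₂ : r₁ ≢ r₂
    r₁≢r₂ r₁≡r₂ = ℕₚ.<⇒≢ r₂<r₁ (sym r₁≡r₂)

    r₁-on-A : + r₁ ≡ V + 1ℤ - K → + r₂ ≡ K × + pointsWithRepl B r₁ ≡ K
    r₁-on-A r₁≡ = r₂≡ , (begin
      + pointsWithRepl B r₁   ≡⟨ count-value (repl B) r₁ (lookup A)
                                   (λ x x∈A → +-injective (trans (replication-inside x x∈A) (sym r₁≡)))
                                   (λ x x∉A r≡r₁ → r₁≢r₂ (+-injective (trans (cong +_ (sym r≡r₁))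
                                                         (trans (replication-outside x x∉A) (sym r₂≡))))) ⟩
      sum (χ A)               ≡⟨ size-as-sum A ⟨
      + ∣ A ∣                 ≡⟨ A-size ⟩
      K                       ∎)
      where
      open ≡-Reasoning
      r₂≡ : + r₂ ≡ K
      r₂≡ = complement r₁+r₂ r₁≡

    r₂-on-A : + r₂ ≡ V + 1ℤ - K → + r₁ ≡ K × + pointsWithRepl B r₁ ≡ V - K
    r₂-on-A r₂≡ = r₁≡ , (begin
      + pointsWithRepl B r₁              ≡⟨ count-value (repl B) r₁ (λ x → not (lookup A x))
                                              (λ x x∉A → +-injective (trans (replication-outside x (not-injective x∉A)) (sym r₁≡)))
                                              (λ x x∈A r≡r₁ → r₁≢r₂ (+-injective (trans (cong +_ (sym r≡r₁))
                                                                    (trans (replication-inside x (not-injective x∈A)) (sym r₂≡))))) ⟩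
      sum (λ x → ⟦ not (lookup A x) ⟧)   ≡⟨ sum-cong-≗ (λ x → ⟦not⟧ (lookup A x)) ⟩
      sum (λ x → 1ℤ - χ A x)             ≡⟨ sum-sub (λ _ → 1ℤ) (χ A) ⟩
      sum {suc n} (λ _ → 1ℤ) - sum (χ A) ≡⟨ cong₂ _-_ (sum-const (suc n) 1ℤ) (trans (sym (size-as-sum A)) A-size) ⟩
      V * 1ℤ - K                         ≡⟨ cong (_- K) (*-identityʳ V) ⟩
      V - K                              ∎)
      where
      open ≡-Reasoning
      r₁≡ : + r₁ ≡ K
      r₁≡ = complement (trans (+-comm (+ r₂) (+ r₁)) r₁+r₂) r₂≡

    -- decide by a point of A
    replication-numbers : Type1Parameters V K (+ r₁) (+ r₂) (+ pointsWithRepl B r₁)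
    replication-numbers with point-of-A
    ... | x₀ , x₀∈A with each x₀
    ...   | inj₁ r₁-at-x₀ = inj₁ (r₁≡ , r₁-on-A r₁≡)
      where
      r₁≡ : + r₁ ≡ V + 1ℤ - K
      r₁≡ = trans (cong +_ (sym r₁-at-x₀)) (replication-inside x₀ x₀∈A)
    ...   | inj₂ r₂-at-x₀ = inj₂ (proj₁ (r₂-on-A r₂≡) , r₂≡ , proj₂ (r₂-on-A r₂≡))
      where
      r₂≡ : + r₂ ≡ V + 1ℤ - K
      r₂≡ = trans (cong +_ (sym r₂-at-x₀)) (replication-inside x₀ x₀∈A)

Conclusion : (V L R₁ R₂ E₁ : ℤ) → Set
Conclusion V L R₁ R₂ E₁ =
    let r = R₁ - R₂
        D = E₁ - R₂
        two = + 2
    in (D ≡ 0ℤ →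
         (∃[ s ] ((+ s) * (+ s) ≡ (two * L - 1ℤ) * (two * L - 1ℤ) + (r - 1ℤ) * (r - 1ℤ) - 1ℤ
                  × (V ≡ two * L + (+ s) ⊎ V ≡ two * L - (+ s))))
         × (∃[ t ] ((+ t) * (+ t) ≡ (two * L - 1ℤ) * (two * L - 1ℤ) + r * (r - two))))
     × (D ≡ -1ℤ →
         (∃[ s ] ((+ s) * (+ s) ≡ (two * L - 1ℤ) * (two * L - 1ℤ) + (r - 1ℤ) * (r - 1ℤ) + (+ 4) * r - 1ℤ
                  × (V ≡ two * L + (+ s) ⊎ V ≡ two * L - (+ s))))
         × (∃[ t ] ((+ t) * (+ t) ≡ (two * L - 1ℤ) * (two * L - 1ℤ) + r * (r + two))))

square-witness : ∀ V T R → (V - T) * (V - T) ≡ R → ∃[ s ] ((+ s) * (+ s) ≡ R × (V ≡ T + (+ s) ⊎ V ≡ T - (+ s)))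
square-witness V T R square = witness (V - T) (split V T) square
  where
  split : ∀ V T → V ≡ T + (V - T)
  split = solve-∀
  witness : ∀ d → V ≡ T + d → d * d ≡ R → ∃[ s ] ((+ s) * (+ s) ≡ R × (V ≡ T + (+ s) ⊎ V ≡ T - (+ s)))
  witness (+ s) V≡T+d d²≡R = s , d²≡R , inj₁ V≡T+d
  witness -[1+ s ] V≡T+d d²≡R = suc s , d²≡R , inj₂ V≡T+d

-- The arithmetic of the theorem.  With λ = k - μ and k² = (k - μ) + v μ, in
-- both cases (v - 2λ)² = (2λ - 1)² + (v - 2k)² - 1 is the claimed square.
module TheoremArithmetic (V K M : ℤ) (fisher : K * K ≡ (K - M) + V * M) where

  L two : ℤ
  L = K - M
  two = + 2

  key-square : (V - two * L) * (V - two * L) ≡ (two * L - 1ℤ) * (two * L - 1ℤ) + (V - two * K) * (V - two * K) - 1ℤ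
  key-square = begin
    (V - two * L) * (V - two * L)                  ≡⟨ expand V K M ⟩
    R + + 4 * ((K - M) + V * M - K * K)            ≡⟨ cong (λ t → R + + 4 * ((K - M) + V * M - t)) fisher ⟩
    R + + 4 * ((K - M) + V * M - ((K - M) + V * M)) ≡⟨ vanish R ((K - M) + V * M) ⟩
    R                                              ∎
    where
    open ≡-Reasoning
    R : ℤ
    R = (two * L - 1ℤ) * (two * L - 1ℤ) + (V - two * K) * (V - two * K) - 1ℤ
    expand : ∀ V K M → (V - + 2 * (K - M)) * (V - + 2 * (K - M))
      ≡ (+ 2 * (K - M) - 1ℤ) * (+ 2 * (K - M) - 1ℤ) + (V - + 2 * K) * (V - + 2 * K) - 1ℤ + + 4 * ((K - M) + V * M - K * K)
    expand = solve-∀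
    vanish : ∀ X E → X + + 4 * (E - E) ≡ X
    vanish = solve-∀

  -- Case r₁ = v + 1 - k, r₂ = k, e₁ = k: here D = 0 and r - 1 = v - 2k.
  conclusion-r₁-on-A : Conclusion V L (V + 1ℤ - K) K K
  conclusion-r₁-on-A = (λ _ → witness , (proj₁ witness , trans (proj₁ (proj₂ witness)) (other-form X r)))
                     , (λ D≡-1 → ⊥-elim (0≢-1 (trans (sym (+-inverseʳ K)) D≡-1)))
    where
    X r square : ℤ
    X = two * L - 1ℤ
    r = (V + 1ℤ - K) - K
    square = X * X + (r - 1ℤ) * (r - 1ℤ) - 1ℤ
    r-form : ∀ X V K → X + (V - + 2 * K) * (V - + 2 * K) - 1ℤ ≡ X + (((V + 1ℤ - K) - K) - 1ℤ) * (((V + 1ℤ - K) - K) - 1ℤ) - 1ℤ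
    r-form = solve-∀
    other-form : ∀ X r → X * X + (r - 1ℤ) * (r - 1ℤ) - 1ℤ ≡ X * X + r * (r - + 2)
    other-form = solve-∀
    witness : ∃[ s ] ((+ s) * (+ s) ≡ square × (V ≡ two * L + (+ s) ⊎ V ≡ two * L - (+ s)))
    witness = square-witness V (two * L) square (trans key-square (r-form (X * X) V K))
    0≢-1 : 0ℤ ≢ -1ℤ
    0≢-1 ()

  -- Case r₁ = k, r₂ = v + 1 - k, e₁ = v - k: here D = -1 and r + 1 = 2k - v.
  conclusion-r₂-on-A : Conclusion V L K (V + 1ℤ - K) (V - K)
  conclusion-r₂-on-A = (λ D≡0 → ⊥-elim (-1≢0 (trans (sym (D≡-1 V K)) D≡0)))
                     , (λ _ → witness , (proj₁ witness , trans (proj₁ (proj₂ witness)) (other-form X r)))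
    where
    X r square : ℤ
    X = two * L - 1ℤ
    r = K - (V + 1ℤ - K)
    square = X * X + (r - 1ℤ) * (r - 1ℤ) + + 4 * r - 1ℤ
    r-form : ∀ X V K → X + (V - + 2 * K) * (V - + 2 * K) - 1ℤ
                       ≡ X + ((K - (V + 1ℤ - K)) - 1ℤ) * ((K - (V + 1ℤ - K)) - 1ℤ) + + 4 * (K - (V + 1ℤ - K)) - 1ℤ
    r-form = solve-∀
    other-form : ∀ X r → X * X + (r - 1ℤ) * (r - 1ℤ) + + 4 * r - 1ℤ ≡ X * X + r * (r + + 2)
    other-form = solve-∀
    D≡-1 : ∀ V K → (V - K) - (V + 1ℤ - K) ≡ -1ℤ
    D≡-1 = solve-∀
    witness : ∃[ s ] ((+ s) * (+ s) ≡ square × (V ≡ two * L + (+ s) ⊎ V ≡ two * L - (+ s)))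
    witness = square-witness V (two * L) square (trans key-square (r-form (X * X) V K))
    -1≢0 : -1ℤ ≢ 0ℤ
    -1≢0 ()

  conclusion : ∀ {L′ R₁ R₂ E₁} → L′ ≡ L → Type1Parameters V K R₁ R₂ E₁ → Conclusion V L′ R₁ R₂ E₁
  conclusion refl (inj₁ (refl , refl , refl)) = conclusion-r₁-on-A
  conclusion refl (inj₂ (refl , refl , refl)) = conclusion-r₂-on-A

-- A Ryser design has two blocks of different sizes, so at least two blocks.
ryser-order≢1 : ∀ {λ'} {B : Fin 1 → Subset 1} → ¬ IsRyser 1 λ' B
ryser-order≢1 ryser with IsRyser.twoSizes ryser
... | zero , zero , sizes-differ = sizes-differ refl

theorem1p11 : (v λ' : ℕ) (B : Fin v → Subset v) → IsRyser v λ' B →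
    (r₁ r₂ : ℕ) → AreReplicationNumbers v B r₁ r₂ → IsType1 v B →
    let r = + r₁ - + r₂
        e₁ = pointsWithRepl B r₁
        D = + e₁ - + r₂
        L = + λ'
        V = + v
        two = + 2
    in (D ≡ 0ℤ →
         (∃[ s ] ((+ s) * (+ s) ≡ (two * L - 1ℤ) * (two * L - 1ℤ) + (r - 1ℤ) * (r - 1ℤ) - 1ℤ
                  × (V ≡ two * L + (+ s) ⊎ V ≡ two * L - (+ s))))
         × (∃[ t ] ((+ t) * (+ t) ≡ (two * L - 1ℤ) * (two * L - 1ℤ) + r * (r - two))))
     × (D ≡ -1ℤ →
         (∃[ s ] ((+ s) * (+ s) ≡ (two * L - 1ℤ) * (two * L - 1ℤ) + (r - 1ℤ) * (r - 1ℤ) + (+ 4) * r - 1ℤ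
                  × (V ≡ two * L + (+ s) ⊎ V ≡ two * L - (+ s))))
         × (∃[ t ] ((+ t) * (+ t) ≡ (two * L - 1ℤ) * (two * L - 1ℤ) + r * (r + two))))
theorem1p11 zero λ' B ryser r₁ r₂ replication type1 = ⊥-elim (¬Fin0 (IsType1.a type1))
theorem1p11 (suc zero) λ' B ryser r₁ r₂ replication type1 = ⊥-elim (ryser-order≢1 ryser)
theorem1p11 (suc (suc n)) λ' B ryser r₁ r₂ replication type1 =
  conclusion (index ryser zero) (replication-numbers replication)
  where
  open Type1 type1 using (V; K; M; fisher; index; replication-numbers)
  open TheoremArithmetic V K M fisher using (conclusion)
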